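{- For all $n\ge0$, $|E(H_3^n)|\le |E(P^n)|\le |E(H_4^n)|$.
   Context: For $m\ge3$, the Hanoi graph $H_m^n$ has vertex set $\{0,\dots,m-1\}^n$ (words $s_n\cdots s_1$, $s_d$ the peg of disc $d$), two words being adjacent iff they differ in exactly one coordinate $d$, with values $i\ne j$ there, and $s_k\notin\{i,j\}$ for all $k<d$. The parity-constrained Hanoi graph $P^n$: with $p(d)=1$ for even $d$, $p(d)=2$ for odd $d$, and $Q^d=\{0,p(d),3\}$, its vertices are the words $s\in\{0,1,2,3\}^n$ with $s_d\in Q^d$ for all $d$, and two vertices are adjacent iff they differ in exactly one coordinate $d$, with values $i\ne j$ there, $i,j\in Q^d$, and $s_k\notin\{i,j\}$ for all $k<d$. -}

module Defs where

open import Data.Nat using (ℕ; zero; suc; _+_)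
open import Data.Nat.Base using (_%_)
open import Data.Bool using (Bool; true; false; _∧_; _∨_; not)
open import Data.Fin using (Fin; toℕ; _≟_; _<?_)
open import Data.Vec using (Vec; []; _∷_; lookup)
open import Data.List.Base using (List; []; _∷_; map; concatMap; filterᵇ; length; allFin)
open import Data.Bool.ListAction using (all; any)
open import Relation.Nullary.Decidable using (⌊_⌋)

-- A word s_n ... s_1 of length n over the pegs {0,...,m-1} is represented as
-- a vector w : Vec (Fin m) n, where the entry at index i : Fin n is the peg of
-- disc d = toℕ i + 1 (so index 0 is the smallest disc 1).
Word : ℕ → ℕ → Set
Word m n = Vec (Fin m) n

allWords : (m n : ℕ) → List (Word m n)
allWords m zero    = [] ∷ []
allWords m (suc n) = concatMap (λ x → map (x ∷_) (allWords m n)) (allFin m)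

eqb : ∀ {m} → Fin m → Fin m → Bool
eqb a b = ⌊ a ≟ b ⌋

adjAt : ∀ {m n} → Word m n → Word m n → Fin n → Bool
adjAt {n = n} u v d =
  not (eqb (lookup u d) (lookup v d))
  ∧ all (λ k → eqb k d ∨ eqb (lookup u k) (lookup v k)) (allFin n)
  ∧ all (λ k → not ⌊ k <? d ⌋
               ∨ (not (eqb (lookup u k) (lookup u d))
                   ∧ not (eqb (lookup u k) (lookup v d))))
        (allFin n)

-- Hanoi adjacency (in H_m^n; also the adjacency of P^n between its vertices)
adjacent : ∀ {m n} → Word m n → Word m n → Bool
adjacent {n = n} u v = any (adjAt u v) (allFin n)

countEdges : ∀ {m n} → List (Word m n) → ℕ
countEdges []       = 0
countEdges (x ∷ xs) = length (filterᵇ (adjacent x) xs) + countEdges xs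

edgesH : ℕ → ℕ → ℕ
edgesH m n = countEdges (allWords m n)

-- Q^d = {0, p(d), 3}, with p(d) = 1 for even d and p(d) = 2 for odd d,
-- where disc d corresponds to index i with d = toℕ i + 1.
inQ : ℕ → Fin 4 → Bool
inQ d x with toℕ x | d % 2
... | 0 | _ = true
... | 3 | _ = true
... | 1 | 0 = true
... | 2 | 1 = true
... | _ | _ = false

isPVertex : ∀ {n} → Word 4 n → Bool
isPVertex {n} w = all (λ i → inQ (suc (toℕ i)) (lookup w i)) (allFin n)

pVertices : (n : ℕ) → List (Word 4 n)
pVertices n = filterᵇ isPVertex (allWords 4 n)

edgesP : ℕ → ℕ
edgesP n = countEdges (pVertices n)

-- Both inequalities compare edge counts along an adjacency-preserving
-- correspondence of vertex lists. P^n is an induced subgraph of H_4^n, whence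
-- the upper bound. For the lower bound, relabel the letters 0, 1, 2 of disc d
-- as 0, p(d), 3: this maps the vertices of H_3^n bijectively onto those of
-- P^n and preserves adjacency, since the relabellings of all discs have a
-- common left inverse, so that distinct pegs stay distinct even across discs.
module Submission where

open import Defs
open import Data.Nat using (ℕ; zero; suc; _≤_; z≤n; s≤s; _%_)
open import Data.Nat.DivMod using (m%n<n)
open import Data.Nat.Properties using (≤-trans; +-mono-≤; m≤n+m; module ≤-Reasoning)
open import Data.Bool.Base using (Bool; true; false; T; _∧_; _∨_; not; if_then_else_)
open import Data.Bool.Properties using (T-∧; T-∨; if-float)
open import Data.Bool.ListAction using (all; any; and)
open import Data.Fin using (Fin; zero; suc; toℕ; #_)
open import Data.Fin.Properties using (_<?_)
open import Data.Vec.Base using (_∷_; lookup; tabulate)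
open import Data.Vec.Properties using (lookup∘tabulate)
open import Data.List.Base using (List; []; _∷_; _++_; map; concatMap; filterᵇ; allFin)
import Data.List.Base as List
open import Data.List.Properties
  using (map-∘; map-tabulate; concatMap-cong; concatMap-map; map-concatMap; filter-≐; filter-++)
open import Data.List.Relation.Binary.Sublist.Heterogeneous using (Sublist; []; _∷_; _∷ʳ_)
open import Data.List.Relation.Binary.Sublist.Heterogeneous.Properties
  using (length-mono-≤; ⊆-filter-Sublist)
open import Data.List.Relation.Binary.Sublist.Propositional.Properties using (filter-⊆)
import Data.List.Relation.Unary.All as All
import Data.List.Relation.Unary.Any as Any
open import Data.List.Relation.Unary.All.Properties using (all⁺; all⁻)
open import Data.List.Relation.Unary.Any.Properties using (any⁺; any⁻)
open import Data.Product using (_×_; _,_)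
import Data.Product as Product
open import Function using (_∘_; id; Equivalence)
open import Relation.Nullary.Decidable
  using (⌊_⌋; T?; toWitness; fromWitness; toWitnessFalse; fromWitnessFalse)
open import Relation.Binary.PropositionalEquality
  using (_≡_; refl; sym; trans; cong; subst; module ≡-Reasoning)

private
  variable
    A B : Set

T-∧-map : ∀ {a b a′ b′} → (T a → T a′) → (T b → T b′) → T (a ∧ b) → T (a′ ∧ b′)
T-∧-map {a} {b} {a′} {b′} f g =
  Equivalence.from (T-∧ {a′} {b′}) ∘ Product.map f g ∘ Equivalence.to (T-∧ {a} {b})

T-∨-mapʳ : ∀ a {b b′} → (T b → T b′) → T (a ∨ b) → T (a ∨ b′)
T-∨-mapʳ true  f _ = _
T-∨-mapʳ false f   = f

T-all-map : ∀ {p q : A → Bool} xs → (∀ x → T (p x) → T (q x)) → T (all p xs) → T (all q xs)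
T-all-map {p = p} {q} xs f = all⁻ q ∘ All.map (f _) ∘ all⁺ p xs

T-any-map : ∀ {p q : A → Bool} xs → (∀ x → T (p x) → T (q x)) → T (any p xs) → T (any q xs)
T-any-map {p = p} {q} xs f = any⁺ q ∘ Any.map (f _) ∘ any⁻ p xs

eqb-map : ∀ {m m′} {a b : Fin m} {a′ b′ : Fin m′} →
          (a ≡ b → a′ ≡ b′) → T (eqb a b) → T (eqb a′ b′)
eqb-map f = fromWitness ∘ f ∘ toWitness

not-eqb-map : ∀ {m m′} {a b : Fin m} {a′ b′ : Fin m′} →
              (a′ ≡ b′ → a ≡ b) → T (not (eqb a b)) → T (not (eqb a′ b′))
not-eqb-map f t = fromWitnessFalse (toWitnessFalse t ∘ f)

filterᵇ-map : (p : B → Bool) (f : A → B) (xs : List A) →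
              filterᵇ p (map f xs) ≡ map f (filterᵇ (p ∘ f) xs)
filterᵇ-map p f [] = refl
filterᵇ-map p f (x ∷ xs) with p (f x)
... | true  = cong (f x ∷_) (filterᵇ-map p f xs)
... | false = filterᵇ-map p f xs

filterᵇ-cong : {p q : A → Bool} → (∀ x → p x ≡ q x) → ∀ xs → filterᵇ p xs ≡ filterᵇ q xs
filterᵇ-cong {p = p} {q} p≗q =
  filter-≐ (T? ∘ p) (T? ∘ q) ((λ {x} → subst T (p≗q x)) , (λ {x} → subst T (sym (p≗q x))))

filterᵇ-guard : ∀ b (p : A → Bool) xs →
                filterᵇ (λ x → b ∧ p x) xs ≡ (if b then filterᵇ p xs else [])
filterᵇ-guard true  p xs       = refl
filterᵇ-guard false p []       = refl
filterᵇ-guard false p (x ∷ xs) = filterᵇ-guard false p xs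

filterᵇ-concatMap : (p : B → Bool) (f : A → List B) (xs : List A) →
                    filterᵇ p (concatMap f xs) ≡ concatMap (filterᵇ p ∘ f) xs
filterᵇ-concatMap p f []       = refl
filterᵇ-concatMap p f (x ∷ xs) =
  trans (filter-++ (T? ∘ p) (f x) (concatMap f xs))
        (cong (filterᵇ p (f x) ++_) (filterᵇ-concatMap p f xs))

concatMap-filterᵇ : (f : A → List B) (p : A → Bool) (xs : List A) →
                    concatMap f (filterᵇ p xs) ≡ concatMap (λ x → if p x then f x else []) xs
concatMap-filterᵇ f p [] = refl
concatMap-filterᵇ f p (x ∷ xs) with p x
... | true  = cong (f x ++_) (concatMap-filterᵇ f p xs)
... | false = concatMap-filterᵇ f p xs

countEdges-mono : ∀ {m m′ n} {R : Word m n → Word m′ n → Set}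
                  {xs : List (Word m n)} {ys : List (Word m′ n)} →
                  (∀ {a a′ b b′} → R a b → R a′ b′ → T (adjacent a a′) → T (adjacent b b′)) →
                  Sublist R xs ys → countEdges xs ≤ countEdges ys
countEdges-mono pres []           = z≤n
countEdges-mono pres (_ ∷ʳ xs⊆ys) = ≤-trans (countEdges-mono pres xs⊆ys) (m≤n+m _ _)
countEdges-mono {xs = x ∷ _} {y ∷ _} pres (r ∷ xs⊆ys) =
  +-mono-≤ (length-mono-≤ (⊆-filter-Sublist (T? ∘ adjacent x) (T? ∘ adjacent y) (pres r) xs⊆ys))
           (countEdges-mono pres xs⊆ys)

⊆-map : (f : A → B) (xs : List A) → Sublist (λ x y → f x ≡ y) xs (map f xs)
⊆-map f []       = []
⊆-map f (x ∷ xs) = refl ∷ ⊆-map f xs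

relabel : ∀ {m m′ n} → (Fin n → Fin m → Fin m′) → Word m n → Word m′ n
relabel h w = tabulate (λ i → h i (lookup w i))

lookup-relabel : ∀ {m m′ n} (h : Fin n → Fin m → Fin m′) w i →
                 lookup (relabel h w) i ≡ h i (lookup w i)
lookup-relabel h w = lookup∘tabulate (λ i → h i (lookup w i))

lettersIn : ∀ {m n} → (Fin n → Fin m → Bool) → Word m n → Bool
lettersIn {n = n} Q w = all (λ i → Q i (lookup w i)) (allFin n)

lettersIn-∷ : ∀ {m n} (Q : Fin (suc n) → Fin m → Bool) x (w : Word m n) →
              lettersIn Q (x ∷ w) ≡ Q zero x ∧ lettersIn (Q ∘ suc) w
lettersIn-∷ {n = n} Q x w = cong (Q zero x ∧_) (cong and (begin
  map p (List.tabulate suc)   ≡⟨ map-tabulate suc p ⟩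
  List.tabulate (p ∘ suc)     ≡⟨ map-tabulate id (p ∘ suc) ⟨
  map (p ∘ suc) (allFin n)    ∎))
  where
  open ≡-Reasoning
  p : Fin (suc n) → Bool
  p i = Q i (lookup (x ∷ w) i)

filterᵇ-map-∷ : ∀ {m n} (Q : Fin (suc n) → Fin m → Bool) x (ws : List (Word m n)) →
                filterᵇ (lettersIn Q) (map (x ∷_) ws)
                ≡ (if Q zero x then map (x ∷_) (filterᵇ (lettersIn (Q ∘ suc)) ws) else [])
filterᵇ-map-∷ Q x ws = begin
  filterᵇ (lettersIn Q) (map (x ∷_) ws)
    ≡⟨ filterᵇ-map (lettersIn Q) (x ∷_) ws ⟩
  map (x ∷_) (filterᵇ (lettersIn Q ∘ (x ∷_)) ws)
    ≡⟨ cong (map (x ∷_)) (filterᵇ-cong (lettersIn-∷ Q x) ws) ⟩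
  map (x ∷_) (filterᵇ (λ w → Q zero x ∧ lettersIn (Q ∘ suc) w) ws)
    ≡⟨ cong (map (x ∷_)) (filterᵇ-guard (Q zero x) (lettersIn (Q ∘ suc)) ws) ⟩
  map (x ∷_) (if Q zero x then filterᵇ (lettersIn (Q ∘ suc)) ws else [])
    ≡⟨ if-float (map (x ∷_)) (Q zero x) ⟩
  (if Q zero x then map (x ∷_) (filterᵇ (lettersIn (Q ∘ suc)) ws) else []) ∎
  where open ≡-Reasoning

filterᵇ-lettersIn-allWords : ∀ {k m} n (Q : Fin n → Fin m → Bool) (h : Fin n → Fin k → Fin m) →
  (∀ i → filterᵇ (Q i) (allFin m) ≡ map (h i) (allFin k)) →
  filterᵇ (lettersIn Q) (allWords m n) ≡ map (relabel h) (allWords k n)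
filterᵇ-lettersIn-allWords zero    Q h Qᵢ≡hᵢ = refl
filterᵇ-lettersIn-allWords {k} {m} (suc n) Q h Qᵢ≡hᵢ = begin
  filterᵇ (lettersIn Q) (concatMap (λ x → map (x ∷_) (allWords m n)) (allFin m))
    ≡⟨ filterᵇ-concatMap (lettersIn Q) (λ x → map (x ∷_) (allWords m n)) (allFin m) ⟩
  concatMap (λ x → filterᵇ (lettersIn Q) (map (x ∷_) (allWords m n))) (allFin m)
    ≡⟨ concatMap-cong (λ x → filterᵇ-map-∷ Q x (allWords m n)) (allFin m) ⟩
  concatMap (λ x → if Q zero x then map (x ∷_) tails else []) (allFin m)
    ≡⟨ concatMap-filterᵇ (λ x → map (x ∷_) tails) (Q zero) (allFin m) ⟨
  concatMap (λ x → map (x ∷_) tails) (filterᵇ (Q zero) (allFin m))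
    ≡⟨ cong (concatMap (λ x → map (x ∷_) tails)) (Qᵢ≡hᵢ zero) ⟩
  concatMap (λ x → map (x ∷_) tails) (map (h zero) (allFin k))
    ≡⟨ concatMap-map (λ x → map (x ∷_) tails) (h zero) (allFin k) ⟩
  concatMap (λ y → map (h zero y ∷_) tails) (allFin k)
    ≡⟨ concatMap-cong (λ y → relabel-∷ y) (allFin k) ⟩
  concatMap (λ y → map (relabel h) (map (y ∷_) (allWords k n))) (allFin k)
    ≡⟨ map-concatMap (relabel h) (λ y → map (y ∷_) (allWords k n)) (allFin k) ⟨
  map (relabel h) (allWords k (suc n)) ∎
  where
  open ≡-Reasoning
  tails : List (Word m n)
  tails = filterᵇ (lettersIn (Q ∘ suc)) (allWords m n)
  IH : tails ≡ map (relabel (h ∘ suc)) (allWords k n)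
  IH = filterᵇ-lettersIn-allWords n (Q ∘ suc) (h ∘ suc) (Qᵢ≡hᵢ ∘ suc)
  relabel-∷ : ∀ y → map (h zero y ∷_) tails ≡ map (relabel h) (map (y ∷_) (allWords k n))
  relabel-∷ y = begin
    map (h zero y ∷_) tails                                     ≡⟨ cong (map (h zero y ∷_)) IH ⟩
    map (h zero y ∷_) (map (relabel (h ∘ suc)) (allWords k n))  ≡⟨ map-∘ (allWords k n) ⟨
    map (relabel h ∘ (y ∷_)) (allWords k n)                     ≡⟨ map-∘ (allWords k n) ⟩
    map (relabel h) (map (y ∷_) (allWords k n))                 ∎

adjacent-relabel : ∀ {m m′ n} (h : Fin n → Fin m → Fin m′) (r : Fin m′ → Fin m) →
                   (∀ i a → r (h i a) ≡ a) →
                   ∀ u v → T (adjacent u v) → T (adjacent (relabel h u) (relabel h v))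
adjacent-relabel {n = n} h r r∘h≡id u v = T-any-map (allFin n) adjAt-relabel
  where
  h-injective : ∀ {i j a b} → h i a ≡ h j b → a ≡ b
  h-injective {i} {j} {a} {b} e = trans (sym (r∘h≡id i a)) (trans (cong r e) (r∘h≡id j b))

  same : ∀ x y i → T (eqb (lookup x i) (lookup y i)) →
         T (eqb (lookup (relabel h x) i) (lookup (relabel h y) i))
  same x y i = eqb-map λ e →
    trans (lookup-relabel h x i) (trans (cong (h i) e) (sym (lookup-relabel h y i)))

  apart : ∀ x y i j → T (not (eqb (lookup x i) (lookup y j))) →
          T (not (eqb (lookup (relabel h x) i) (lookup (relabel h y) j)))
  apart x y i j = not-eqb-map λ e →
    h-injective (trans (sym (lookup-relabel h x i)) (trans e (lookup-relabel h y j)))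

  u′ v′ : Word _ n
  u′ = relabel h u
  v′ = relabel h v

  moved-disc : ∀ d → T (not (eqb (lookup u d) (lookup v d))) →
                     T (not (eqb (lookup u′ d) (lookup v′ d)))
  moved-disc d = apart u v d d

  unmoved-discs : ∀ d → T (all (λ k → eqb k d ∨ eqb (lookup u k) (lookup v k)) (allFin n)) →
                        T (all (λ k → eqb k d ∨ eqb (lookup u′ k) (lookup v′ k)) (allFin n))
  unmoved-discs d = T-all-map (allFin n) λ k → T-∨-mapʳ (eqb k d) (same u v k)

  smaller-discs-elsewhere :
    ∀ d → T (all (λ k → not ⌊ k <? d ⌋ ∨ (not (eqb (lookup u k) (lookup u d))
                                          ∧ not (eqb (lookup u k) (lookup v d)))) (allFin n)) →
          T (all (λ k → not ⌊ k <? d ⌋ ∨ (not (eqb (lookup u′ k) (lookup u′ d))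
                                          ∧ not (eqb (lookup u′ k) (lookup v′ d)))) (allFin n))
  smaller-discs-elsewhere d = T-all-map (allFin n) λ k →
    T-∨-mapʳ (not ⌊ k <? d ⌋) (T-∧-map (apart u u k d) (apart u v k d))

  adjAt-relabel : ∀ d → T (adjAt u v d) → T (adjAt u′ v′ d)
  adjAt-relabel d = T-∧-map (moved-disc d) (T-∧-map (unmoved-discs d) (smaller-discs-elsewhere d))

toQ : ℕ → Fin 3 → Fin 4
toQ d zero             = # 0
toQ d (suc zero) with d % 2
... | 0                = # 1
... | _                = # 2
toQ d (suc (suc zero)) = # 3

fromQ : Fin 4 → Fin 3
fromQ zero                   = # 0
fromQ (suc zero)             = # 1
fromQ (suc (suc zero))       = # 1
fromQ (suc (suc (suc zero))) = # 2

fromQ-toQ : ∀ d a → fromQ (toQ d a) ≡ a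
fromQ-toQ d zero             = refl
fromQ-toQ d (suc zero) with d % 2
... | 0                      = refl
... | suc _                  = refl
fromQ-toQ d (suc (suc zero)) = refl

filterᵇ-inQ : ∀ d → filterᵇ (inQ d) (allFin 4) ≡ map (toQ d) (allFin 3)
filterᵇ-inQ d with d % 2 | m%n<n d 2
... | 0           | _ = refl
... | 1           | _ = refl
... | suc (suc _) | s≤s (s≤s ())

proposition6p4 : (n : ℕ) → edgesH 3 n ≤ edgesP n × edgesP n ≤ edgesH 4 n
proposition6p4 n = lower , upper
  where
  discQ : Fin n → Fin 3 → Fin 4
  discQ i = toQ (suc (toℕ i))

  pVertices≡image : pVertices n ≡ map (relabel discQ) (allWords 3 n)
  pVertices≡image =
    filterᵇ-lettersIn-allWords n (λ i → inQ (suc (toℕ i))) discQ (λ i → filterᵇ-inQ (suc (toℕ i)))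

  lower : edgesH 3 n ≤ edgesP n
  lower = begin
    edgesH 3 n
      ≤⟨ countEdges-mono (λ { {a} {a′} refl refl → adjacent-relabel discQ fromQ fromQ-discQ a a′ })
                         (⊆-map (relabel discQ) (allWords 3 n)) ⟩
    countEdges (map (relabel discQ) (allWords 3 n))
      ≡⟨ cong countEdges pVertices≡image ⟨
    edgesP n ∎
    where
    open ≤-Reasoning
    fromQ-discQ : ∀ i a → fromQ (discQ i a) ≡ a
    fromQ-discQ i = fromQ-toQ (suc (toℕ i))

  upper : edgesP n ≤ edgesH 4 n
  upper = countEdges-mono (λ { refl refl → id }) (filter-⊆ (T? ∘ isPVertex) (allWords 4 n))
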